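{- If $G$ is a finite simple graph without isolated vertices, then $B(G)\leq Z(L(G))$, where $B$ denotes the brushing number, $Z$ the zero forcing number, and $L(G)$ the line graph of $G$.
   Context: All graphs are non-empty, simple, finite and undirected; $[k]=\{1,\ldots,k\}$. The zero forcing number $Z(G)$ of a graph $G$ with $n$ vertices is the minimum positive integer $k$ for which there are $k$ vertices $u_1,\ldots,u_k$ of $G$ and a linear order $u_{k+1},\ldots,u_n$ of the remaining vertices such that for every $j\in\{k+1,\ldots,n\}$ there is some $i\in[j-1]$ such that $u_j$ is the unique neighbor of $u_i$ in $G$ contained in $\{u_j,u_{j+1},\ldots,u_n\}$ (one says $u_i$ forces $u_j$). The brushing number $B(G)$ is the minimum positive integer $k$ for which there is an acyclic orientation $\vec{G}$ of $G$ and $k$ directed paths in $\vec{G}$ such that every directed edge of $\vec{G}$ belongs to at least one of these paths. The line graph $L(G)$ has vertex set $E(G)$, two vertices being adjacent iff the corresponding edges of $G$ share an endpoint. -}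

module Defs where

open import Data.Nat using (ℕ; _≤_)
open import Data.Fin using (Fin; toℕ) renaming (_<_ to _<ᶠ_; _≤_ to _≤ᶠ_)
open import Data.Bool using (Bool; true; false)
open import Data.Product using (Σ; ∃; _×_; _,_; proj₁; proj₂)
open import Data.Sum using (_⊎_)
open import Data.List using (List; []; _∷_)
open import Data.List.Relation.Unary.Unique.Propositional using (Unique)
open import Relation.Binary.PropositionalEquality using (_≡_)
open import Relation.Nullary using (¬_)
open import Function.Definitions using (Bijective)

record SimpleGraph (n : ℕ) : Set where
  field
    adj     : Fin n → Fin n → Bool
    adj-sym : ∀ u v → adj u v ≡ adj v u
    loopless : ∀ u → adj u u ≡ false
open SimpleGraph public

NoIsolatedVertices : ∀ {n} → SimpleGraph n → Set
NoIsolatedVertices G = ∀ u → ∃ λ v → adj G u v ≡ true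

-- Line graph.  An edge {u,v} of G is represented uniquely by the pair
-- (u , v) with u < v and adj u v ≡ true.

Edge : ∀ {n} → SimpleGraph n → Set
Edge {n} G = Σ (Fin n × Fin n) λ p → (proj₁ p <ᶠ proj₂ p) × (adj G (proj₁ p) (proj₂ p) ≡ true)

endpoints : ∀ {n} {G : SimpleGraph n} → Edge G → Fin n × Fin n
endpoints e = proj₁ e

LineAdj : ∀ {n} (G : SimpleGraph n) → Edge G → Edge G → Set
LineAdj G ((u , v) , _) ((u' , v') , _) =
  ¬ (u ≡ u' × v ≡ v') × (u ≡ u' ⊎ u ≡ v' ⊎ v ≡ u' ⊎ v ≡ v')

-- Z = least positive k with HasZeroForcing Adj k.

HasZeroForcing : {V : Set} → (V → V → Set) → ℕ → Set
HasZeroForcing {V} Adj k =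
  Σ ℕ λ m → Σ (Fin m → V) λ u →
    Bijective _≡_ _≡_ u × k ≤ m ×
    (∀ (j : Fin m) → k ≤ toℕ j →
       ∃ λ (i : Fin m) → (i <ᶠ j) × Adj (u i) (u j) ×
         (∀ (l : Fin m) → j ≤ᶠ l → Adj (u i) (u l) → l ≡ j))

IsOrientation : ∀ {n} → SimpleGraph n → (Fin n → Fin n → Bool) → Set
IsOrientation {n} G d =
  (∀ u v → d u v ≡ true → adj G u v ≡ true) ×
  (∀ u v → adj G u v ≡ true → d u v ≡ true ⊎ d v u ≡ true) ×
  (∀ u v → ¬ (d u v ≡ true × d v u ≡ true))

data Reach {n} (d : Fin n → Fin n → Bool) : Fin n → Fin n → Set where
  arc  : ∀ {u v} → d u v ≡ true → Reach d u v
  _◅_  : ∀ {u v w} → d u v ≡ true → Reach d v w → Reach d u w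

Acyclic : ∀ {n} → (Fin n → Fin n → Bool) → Set
Acyclic {n} d = ∀ (v : Fin n) → ¬ Reach d v v

data Consec {A : Set} : List A → A → A → Set where
  here  : ∀ {x y xs} → Consec (x ∷ y ∷ xs) x y
  there : ∀ {z x y xs} → Consec xs x y → Consec (z ∷ xs) x y

IsDirPath : ∀ {n} → (Fin n → Fin n → Bool) → List (Fin n) → Set
IsDirPath d p = Unique p × (∀ u v → Consec p u v → d u v ≡ true)

-- G can be brushed by k directed paths of some acyclic orientation
-- covering all arcs.  B = least positive k with Brushable G k.
Brushable : ∀ {n} → SimpleGraph n → ℕ → Set
Brushable {n} G k =
  Σ (Fin n → Fin n → Bool) λ d → IsOrientation G d × Acyclic d ×
    Σ (Fin k → List (Fin n)) λ P → (∀ i → IsDirPath d (P i)) ×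
      (∀ u v → d u v ≡ true → ∃ λ i → Consec (P i) u v)

-- Number the edges e_0, …, e_{m-1} in forcing order, e_0, …, e_{k-1} being the initial set.  If e_a
-- forces e_l, the vertex they share has e_l as its last incident edge, while every edge at the other
-- endpoint of e_a comes before e_l: an edge after e_l meeting e_a would be a second neighbour of e_a.
-- So orient each edge towards the endpoint whose last incident edge comes later, breaking a tie (both
-- endpoints closing at this very edge) towards the vertex shared with the forcer.  Then e_a enters
-- and e_l leaves their common vertex, so following forcings from each initial edge traces k directed
-- walks that together cover every edge.  Along every arc x → y the potential
-- 2 · (index of the last edge at v) + [v is the head of that edge] strictly increases, so the
-- orientation is acyclic and the walks are paths.
module Submission where

open import Defs
open import Data.Nat using (ℕ; _≤_)
open import Data.Product using (Σ; _×_)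

open import Axiom.UniquenessOfIdentityProofs using (module Decidable⇒UIP)
open import Data.Bool using (Bool; true; false; if_then_else_)
import Data.Bool as Bool
open import Data.Empty using (⊥-elim)
open import Data.Fin as Fin using (Fin; zero; suc; toℕ; fromℕ<; inject≤)
  renaming (_<_ to _<ᶠ_; _≤_ to _≤ᶠ_)
open import Data.Fin.Properties using (any?; toℕ-injective; toℕ<n; toℕ-inject≤; toℕ-fromℕ<)
  renaming (<-cmp to <ᶠ-cmp)
open import Data.List using (List; []; _∷_)
open import Data.List.Relation.Binary.Pointwise using (Pointwise-≡⇒≡; ≡⇒Pointwise-≡)
open import Data.List.Relation.Binary.Suffix.Heterogeneous as Suffix using (Suffix; here; there)
open import Data.List.Relation.Unary.All as All using (All; []; _∷_)
open import Data.List.Relation.Unary.AllPairs using ([]; _∷_)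
open import Data.List.Relation.Unary.Unique.Propositional using (Unique)
open import Data.Maybe using (Maybe; just; nothing; maybe)
open import Data.Nat using (zero; suc; _+_; _<_; z≤n; s≤s; _≤?_)
open import Data.Nat.Properties
  using (<-cmp; <-irrefl; <-asym; <-trans; <-≤-trans; ≤-<-trans; ≤-trans; ≤-refl; ≤-reflexive; ≤-antisym;
         ≤-total; <⇒≤; ≰⇒>; ≤-pred; n<1+n; m≤n+m; +-suc; +-identityʳ; +-monoˡ-≤; +-mono-≤;
         m≤n⇒m<n∨m≡n; <-irrelevant; ≤-irrelevant; module ≤-Reasoning)
open import Data.Product using (∃; _,_; proj₁; proj₂; map₂)
open import Data.Sum using (_⊎_; inj₁; inj₂; [_,_]′)
open import Function using (_∘_; id)
open import Function.Definitions using (Injective)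
open import Relation.Binary using (tri<; tri≈; tri>)
open import Relation.Binary.PropositionalEquality using (_≡_; _≢_; refl; sym; trans; cong; cong₂; subst; subst₂)
open import Relation.Nullary using (¬_; Dec; yes; no; does; _×-dec_; _⊎-dec_)
open import Relation.Nullary.Decidable using (dec-true; dec-false)
open import Relation.Unary using (Pred; Decidable)

does-true⇒ : ∀ {a} {A : Set a} (a? : Dec A) → does a? ≡ true → A
does-true⇒ (yes a) _ = a

greatest : ∀ {m p} {P : Pred (Fin m) p} → Decidable P → ∃ P →
           Σ (Fin m) λ j → P j × (∀ i → P i → i ≤ᶠ j)
greatest {suc m} P? (j₀ , Pj₀) with any? (P? ∘ suc)
... | yes ∃P∘suc with greatest (P? ∘ suc) ∃P∘suc
...   | j , Pj , maximal = suc j , Pj , λ { zero _ → z≤n ; (suc i) Pi → s≤s (maximal i Pi) }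
greatest {suc m} {P = P} P? (j₀ , Pj₀) | no ¬∃P∘suc =
  zero , P-zero j₀ Pj₀ , λ { zero _ → z≤n ; (suc i) Pi → ⊥-elim (¬∃P∘suc (i , Pi)) }
  where
  P-zero : ∀ j → P j → P zero
  P-zero zero    Pj = Pj
  P-zero (suc j) Pj = ⊥-elim (¬∃P∘suc (j , Pj))

Consec-suffix : ∀ {A : Set} {xs ys : List A} {a b} → Suffix _≡_ xs ys → Consec xs a b → Consec ys a b
Consec-suffix (here xs≋ys) c rewrite Pointwise-≡⇒≡ xs≋ys = c
Consec-suffix (there s)    c = there (Consec-suffix s c)

module _ {A : Set} (rank : A → ℕ) where

  increasing⇒Unique : ∀ xs → (∀ {a b} → Consec xs a b → rank a < rank b) → Unique xs
  increasing⇒Unique []       _   = []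
  increasing⇒Unique (x ∷ xs) inc =
    All.map (λ x<y x≡y → <-irrefl (cong rank x≡y) x<y) (later-larger x xs inc)
      ∷ increasing⇒Unique xs (inc ∘ there)
    where
    later-larger : ∀ x xs → (∀ {a b} → Consec (x ∷ xs) a b → rank a < rank b) →
                   All (λ y → rank x < rank y) xs
    later-larger x []       _   = []
    later-larger x (y ∷ ys) inc =
      inc here ∷ All.map (<-trans (inc here)) (later-larger y ys (inc ∘ there))

increasing⇒Acyclic : ∀ {n} {d : Fin n → Fin n → Bool} (rank : Fin n → ℕ) →
                     (∀ {x y} → d x y ≡ true → rank x < rank y) → Acyclic d
increasing⇒Acyclic {d = d} rank inc v = <-irrefl refl ∘ Reach⇒<
  where
  Reach⇒< : ∀ {x y} → Reach d x y → rank x < rank y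
  Reach⇒< (arc xy)   = inc xy
  Reach⇒< (xy ◅ yz) = <-trans (inc xy) (Reach⇒< yz)

double-< : ∀ {a b} → a < b → suc (a + a) < b + b
double-< {a} {b} a<b = subst (_≤ b + b) (cong suc (+-suc a a)) (+-mono-≤ a<b a<b)

module Edges {n : ℕ} (G : SimpleGraph n) where

  lo hi : Edge G → Fin n
  lo e = proj₁ (endpoints {G = G} e)
  hi e = proj₂ (endpoints {G = G} e)

  _∈ₑ_ : Fin n → Edge G → Set
  v ∈ₑ e = v ≡ lo e ⊎ v ≡ hi e

  _∈ₑ?_ : ∀ v e → Dec (v ∈ₑ e)
  v ∈ₑ? e = (v Fin.≟ lo e) ⊎-dec (v Fin.≟ hi e)

  data Meets (e e' : Edge G) : Set where
    meet : ∀ v → v ∈ₑ e → v ∈ₑ e' → Meets e e'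

  lo<hi : ∀ e → lo e <ᶠ hi e
  lo<hi e = proj₁ (proj₂ e)

  lo≢hi : ∀ e → lo e ≢ hi e
  lo≢hi e eq = <-irrefl (cong toℕ eq) (lo<hi e)

  Edge-≡ : ∀ {e e'} → lo e ≡ lo e' → hi e ≡ hi e' → e ≡ e'
  Edge-≡ {(a , b) , a<b , a~b} {(.a , .b) , a<b' , a~b'} refl refl =
    cong₂ (λ p q → (a , b) , p , q) (<-irrelevant a<b a<b')
          (Decidable⇒UIP.≡-irrelevant Bool._≟_ a~b a~b')

  ∈ₑ-both : ∀ {v w} e → v ≢ w → v ∈ₑ e → w ∈ₑ e → (v ≡ lo e × w ≡ hi e) ⊎ (v ≡ hi e × w ≡ lo e)
  ∈ₑ-both e v≢w (inj₁ p) (inj₁ q) = ⊥-elim (v≢w (trans p (sym q)))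
  ∈ₑ-both e v≢w (inj₁ p) (inj₂ q) = inj₁ (p , q)
  ∈ₑ-both e v≢w (inj₂ p) (inj₁ q) = inj₂ (p , q)
  ∈ₑ-both e v≢w (inj₂ p) (inj₂ q) = ⊥-elim (v≢w (trans p (sym q)))

  edge-by-endpoints : ∀ {v w e e'} → v ≢ w → v ∈ₑ e → w ∈ₑ e → v ∈ₑ e' → w ∈ₑ e' → e ≡ e'
  edge-by-endpoints {e = e} {e'} v≢w v∈e w∈e v∈e' w∈e'
    with ∈ₑ-both e v≢w v∈e w∈e | ∈ₑ-both e' v≢w v∈e' w∈e'
  ... | inj₁ (p , q) | inj₁ (p' , q') = Edge-≡ (trans (sym p) p') (trans (sym q) q')
  ... | inj₂ (p , q) | inj₂ (p' , q') = Edge-≡ (trans (sym q) q') (trans (sym p) p')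
  ... | inj₁ (p , q) | inj₂ (p' , q') =
    ⊥-elim (<-asym (lo<hi e) (subst₂ _<ᶠ_ (trans (sym q') q) (trans (sym p') p) (lo<hi e')))
  ... | inj₂ (p , q) | inj₁ (p' , q') =
    ⊥-elim (<-asym (lo<hi e) (subst₂ _<ᶠ_ (trans (sym p') p) (trans (sym q') q) (lo<hi e')))

  shared-vertex-unique : ∀ {v w e e'} → e ≢ e' → v ∈ₑ e → v ∈ₑ e' → w ∈ₑ e → w ∈ₑ e' → v ≡ w
  shared-vertex-unique {v} {w} e≢e' v∈e v∈e' w∈e w∈e' with v Fin.≟ w
  ... | yes v≡w = v≡w
  ... | no v≢w  = ⊥-elim (e≢e' (edge-by-endpoints v≢w v∈e w∈e v∈e' w∈e'))

  LineAdj⇒Meets : ∀ e e' → LineAdj G e e' → Meets e e'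
  LineAdj⇒Meets ((a , b) , _) _ (_ , inj₁ eq)                 = meet a (inj₁ refl) (inj₁ eq)
  LineAdj⇒Meets ((a , b) , _) _ (_ , inj₂ (inj₁ eq))          = meet a (inj₁ refl) (inj₂ eq)
  LineAdj⇒Meets ((a , b) , _) _ (_ , inj₂ (inj₂ (inj₁ eq)))   = meet b (inj₂ refl) (inj₁ eq)
  LineAdj⇒Meets ((a , b) , _) _ (_ , inj₂ (inj₂ (inj₂ eq)))   = meet b (inj₂ refl) (inj₂ eq)

  Meets⇒LineAdj : ∀ e e' → e ≢ e' → Meets e e' → LineAdj G e e'
  Meets⇒LineAdj e e' e≢e' (meet v v∈e v∈e') = (λ (p , q) → e≢e' (Edge-≡ p q)) , shares v∈e v∈e'
    where
    shares : ∀ {v} → v ∈ₑ e → v ∈ₑ e' →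
             lo e ≡ lo e' ⊎ lo e ≡ hi e' ⊎ hi e ≡ lo e' ⊎ hi e ≡ hi e'
    shares (inj₁ p) (inj₁ q) = inj₁ (trans (sym p) q)
    shares (inj₁ p) (inj₂ q) = inj₂ (inj₁ (trans (sym p) q))
    shares (inj₂ p) (inj₁ q) = inj₂ (inj₂ (inj₁ (trans (sym p) q)))
    shares (inj₂ p) (inj₂ q) = inj₂ (inj₂ (inj₂ (trans (sym p) q)))

  adj⇒≢ : ∀ {x y} → adj G x y ≡ true → x ≢ y
  adj⇒≢ {x} x~x refl with () ← trans (sym x~x) (loopless G x)

  adj⇒edge : ∀ {x y} → adj G x y ≡ true → ∃ λ e → x ∈ₑ e × y ∈ₑ e
  adj⇒edge {x} {y} x~y with <ᶠ-cmp x y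
  ... | tri< x<y _ _ = ((x , y) , x<y , x~y) , inj₁ refl , inj₂ refl
  ... | tri≈ _ x≡y _ = ⊥-elim (adj⇒≢ x~y x≡y)
  ... | tri> _ _ y<x = ((y , x) , y<x , trans (adj-sym G y x) x~y) , inj₂ refl , inj₁ refl

  tailOf headOf : Bool → Edge G → Fin n
  tailOf true  = lo
  tailOf false = hi
  headOf true  = hi
  headOf false = lo

  tailOf-∈ₑ : ∀ b e → tailOf b e ∈ₑ e
  tailOf-∈ₑ true  e = inj₁ refl
  tailOf-∈ₑ false e = inj₂ refl

  headOf-∈ₑ : ∀ b e → headOf b e ∈ₑ e
  headOf-∈ₑ true  e = inj₂ refl
  headOf-∈ₑ false e = inj₁ refl

  tailOf≢headOf : ∀ b e → tailOf b e ≢ headOf b e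
  tailOf≢headOf true  e = lo≢hi e
  tailOf≢headOf false e = lo≢hi e ∘ sym

  adj-tailOf-headOf : ∀ b e → adj G (tailOf b e) (headOf b e) ≡ true
  adj-tailOf-headOf true  e = proj₂ (proj₂ e)
  adj-tailOf-headOf false e = trans (adj-sym G (hi e) (lo e)) (proj₂ (proj₂ e))

  Meets-sym : ∀ {e e'} → Meets e e' → Meets e' e
  Meets-sym (meet v v∈e v∈e') = meet v v∈e' v∈e

  Meets⇒tailOf⊎headOf : ∀ b e e' → Meets e e' → tailOf b e ∈ₑ e' ⊎ headOf b e ∈ₑ e'
  Meets⇒tailOf⊎headOf true  _ _ (meet v (inj₁ refl) v∈e') = inj₁ v∈e'
  Meets⇒tailOf⊎headOf true  _ _ (meet v (inj₂ refl) v∈e') = inj₂ v∈e'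
  Meets⇒tailOf⊎headOf false _ _ (meet v (inj₁ refl) v∈e') = inj₂ v∈e'
  Meets⇒tailOf⊎headOf false _ _ (meet v (inj₂ refl) v∈e') = inj₁ v∈e'

  oriented-endpoints : ∀ b {x y} e → x ≢ y → x ∈ₑ e → y ∈ₑ e →
    (tailOf b e ≡ x × headOf b e ≡ y) ⊎ (tailOf b e ≡ y × headOf b e ≡ x)
  oriented-endpoints true  e x≢y x∈e y∈e with ∈ₑ-both e x≢y x∈e y∈e
  ... | inj₁ (p , q) = inj₁ (sym p , sym q)
  ... | inj₂ (p , q) = inj₂ (sym q , sym p)
  oriented-endpoints false e x≢y x∈e y∈e with ∈ₑ-both e x≢y x∈e y∈e
  ... | inj₁ (p , q) = inj₂ (sym q , sym p)
  ... | inj₂ (p , q) = inj₁ (sym p , sym q)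

module FromZeroForcing {n : ℕ} (G : SimpleGraph n) (noIso : NoIsolatedVertices G)
  {k m : ℕ} (u : Fin m → Edge G) (u-injective : Injective _≡_ _≡_ u)
  (u-surjective : ∀ e → ∃ λ j → u j ≡ e) (k≤m : k ≤ m)
  (forcing : ∀ (j : Fin m) → k ≤ toℕ j → ∃ λ (i : Fin m) → (i <ᶠ j) × LineAdj G (u i) (u j) ×
               (∀ (l : Fin m) → j ≤ᶠ l → LineAdj G (u i) (u l) → l ≡ j))
  where

  open Edges G

  u-<-distinct : ∀ {i j} → i <ᶠ j → u i ≢ u j
  u-<-distinct i<j ui≡uj = <-irrefl (cong toℕ (u-injective ui≡uj)) i<j

  forcer : (j : Fin m) → k ≤ toℕ j → Fin m
  forcer j p = proj₁ (forcing j p)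

  forcer< : ∀ j p → forcer j p <ᶠ j
  forcer< j p = proj₁ (proj₂ (forcing j p))

  forcer-meets : ∀ j p → Meets (u (forcer j p)) (u j)
  forcer-meets j p = LineAdj⇒Meets (u (forcer j p)) (u j) (proj₁ (proj₂ (proj₂ (forcing j p))))

  forcer-irrelevant : ∀ j p q → forcer j p ≡ forcer j q
  forcer-irrelevant j p q = cong (forcer j) (≤-irrelevant p q)

  Forces : Fin m → Fin m → Set
  Forces a j = Σ (k ≤ toℕ j) λ p → forcer j p ≡ a

  Forces? : ∀ a j → Dec (Forces a j)
  Forces? a j with k ≤? toℕ j
  ... | no k≰j = no (k≰j ∘ proj₁)
  ... | yes p with forcer j p Fin.≟ a
  ...   | yes eq = yes (p , eq)
  ...   | no neq = no (λ (q , eq) → neq (trans (forcer-irrelevant j p q) eq))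

  shares-forcer-vertex⇒≡ : ∀ {a l j x} → Forces a l → x ∈ₑ u a → x ∈ₑ u j → l ≤ᶠ j → j ≡ l
  shares-forcer-vertex⇒≡ {l = l} {j} (p , refl) x∈a x∈j l≤j =
    proj₂ (proj₂ (proj₂ (forcing l p))) j l≤j
      (Meets⇒LineAdj _ _ (u-<-distinct (<-≤-trans (forcer< l p) l≤j)) (meet _ x∈a x∈j))

  Forces⇒Meets : ∀ {a j} → Forces a j → Meets (u a) (u j)
  Forces⇒Meets {j = j} (p , refl) = forcer-meets j p

  Forces-injective : ∀ {a j j'} → Forces a j → Forces a j' → j ≡ j'
  Forces-injective {j = j} {j'} a⇒j a⇒j'
    with ≤-total (toℕ j) (toℕ j') | Forces⇒Meets a⇒j | Forces⇒Meets a⇒j'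
  ... | inj₁ j≤j' | _                | meet x x∈a x∈j' = sym (shares-forcer-vertex⇒≡ a⇒j x∈a x∈j' j≤j')
  ... | inj₂ j'≤j | meet x x∈a x∈j | _                = shares-forcer-vertex⇒≡ a⇒j' x∈a x∈j j'≤j

  forcee : Fin m → Maybe (Fin m)
  forcee a with any? (Forces? a)
  ... | yes (j , _) = just j
  ... | no _        = nothing

  forcee-sound : ∀ {a j} → forcee a ≡ just j → Forces a j
  forcee-sound {a} eq with any? (Forces? a)
  forcee-sound refl | yes (j , a⇒j) = a⇒j

  forcee-complete : ∀ {a j} → Forces a j → forcee a ≡ just j
  forcee-complete {a} a⇒j with any? (Forces? a)
  ... | yes (j' , a⇒j') = cong just (Forces-injective a⇒j' a⇒j)
  ... | no ¬∃           = ⊥-elim (¬∃ (_ , a⇒j))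

  incident-edge : ∀ v → ∃ λ j → v ∈ₑ u j
  incident-edge v with adj⇒edge (proj₂ (noIso v))
  ... | e , v∈e , _ with u-surjective e
  ...   | j , refl = j , v∈e

  -- Opaque: unfolding the search inside greatest makes later conversion checks blow up.
  opaque
    lastEdge : Fin n → Fin m
    lastEdge v = proj₁ (greatest (λ j → v ∈ₑ? u j) (incident-edge v))

    lastEdge-∋ : ∀ v → v ∈ₑ u (lastEdge v)
    lastEdge-∋ v = proj₁ (proj₂ (greatest (λ j → v ∈ₑ? u j) (incident-edge v)))

    lastEdge-greatest : ∀ {v j} → v ∈ₑ u j → j ≤ᶠ lastEdge v
    lastEdge-greatest {v} {j} = proj₂ (proj₂ (greatest (λ j → v ∈ₑ? u j) (incident-edge v))) j

  lastTime : Fin n → ℕ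
  lastTime v = toℕ (lastEdge v)

  lastEdge-forced : ∀ {a l x} → Forces a l → x ∈ₑ u a → x ∈ₑ u l → lastEdge x ≡ l
  lastEdge-forced a⇒l x∈a x∈l = shares-forcer-vertex⇒≡ a⇒l x∈a (lastEdge-∋ _) (lastEdge-greatest x∈l)

  lastEdge<forced : ∀ {a l x} → Forces a l → x ∈ₑ u a → ¬ x ∈ₑ u l → lastEdge x <ᶠ l
  lastEdge<forced {l = l} {x} a⇒l x∈a x∉l with toℕ l ≤? lastTime x
  ... | no l≰last   = ≰⇒> l≰last
  ... | yes l≤last = ⊥-elim (x∉l (subst (λ j → x ∈ₑ u j) last≡l (lastEdge-∋ x)))
    where
    last≡l : lastEdge x ≡ l
    last≡l = shares-forcer-vertex⇒≡ a⇒l x∈a (lastEdge-∋ x) l≤last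

  tieBreak : Fin m → Bool
  tieBreak j with k ≤? toℕ j
  ... | no _  = true
  ... | yes p with lo (u j) ∈ₑ? u (forcer j p)
  ...   | yes _ = true
  ...   | no _  = false

  upward : Fin m → Bool
  upward j with <-cmp (lastTime (lo (u j))) (lastTime (hi (u j)))
  ... | tri< _ _ _ = true
  ... | tri≈ _ _ _ = tieBreak j
  ... | tri> _ _ _ = false

  tail head : Fin m → Fin n
  tail j = tailOf (upward j) (u j)
  head j = headOf (upward j) (u j)

  tail∈ : ∀ j → tail j ∈ₑ u j
  tail∈ j = tailOf-∈ₑ (upward j) (u j)

  head∈ : ∀ j → head j ∈ₑ u j
  head∈ j = headOf-∈ₑ (upward j) (u j)

  tail≢head : ∀ j → tail j ≢ head j
  tail≢head j = tailOf≢headOf (upward j) (u j)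

  lastTime-tail≤head : ∀ j → lastTime (tail j) ≤ lastTime (head j)
  lastTime-tail≤head j with <-cmp (lastTime (lo (u j))) (lastTime (hi (u j)))
  ... | tri< lo<hi _ _ = <⇒≤ lo<hi
  ... | tri> _ _ hi<lo = <⇒≤ hi<lo
  ... | tri≈ _ lo≡hi _ = at-tie (tieBreak j)
    where
    at-tie : ∀ b → lastTime (tailOf b (u j)) ≤ lastTime (headOf b (u j))
    at-tie true  = ≤-reflexive lo≡hi
    at-tie false = ≤-reflexive (sym lo≡hi)

  tail∈forcer-at-tie : ∀ j p → lastTime (tail j) ≡ lastTime (head j) → tail j ∈ₑ u (forcer j p)
  tail∈forcer-at-tie j p tie with <-cmp (lastTime (lo (u j))) (lastTime (hi (u j)))
  ... | tri< lo<hi _ _ = ⊥-elim (<-irrefl tie lo<hi)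
  ... | tri> _ _ hi<lo = ⊥-elim (<-irrefl tie hi<lo)
  ... | tri≈ _ _ _ with k ≤? toℕ j
  ...   | no k≰j = ⊥-elim (k≰j p)
  ...   | yes p' rewrite forcer-irrelevant j p p' with lo (u j) ∈ₑ? u (forcer j p')
  ...     | yes lo∈F = lo∈F
  ...     | no lo∉F  =
    [ ⊥-elim ∘ lo∉F , id ]′ (Meets⇒tailOf⊎headOf true (u j) (u (forcer j p')) (Meets-sym (forcer-meets j p')))

  tail∈forcer : ∀ j p → tail j ∈ₑ u (forcer j p)
  tail∈forcer j p with tail j ∈ₑ? u (forcer j p)
  ... | yes tail∈F = tail∈F
  ... | no tail∉F  = tail∈forcer-at-tie j p (≤-antisym (lastTime-tail≤head j) head≤tail)
    where
    head∈F : head j ∈ₑ u (forcer j p)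
    head∈F = [ ⊥-elim ∘ tail∉F , id ]′
      (Meets⇒tailOf⊎headOf (upward j) (u j) (u (forcer j p)) (Meets-sym (forcer-meets j p)))
    head≤tail : lastTime (head j) ≤ lastTime (tail j)
    head≤tail = subst (_≤ lastTime (tail j)) (sym (cong toℕ (lastEdge-forced (p , refl) head∈F (head∈ j))))
                      (lastEdge-greatest (tail∈ j))

  head∈forcee : ∀ {j l} → Forces j l → head j ∈ₑ u l
  head∈forcee {j} {l} j⇒l with head j ∈ₑ? u l
  ... | yes head∈l = head∈l
  ... | no head∉l  = ⊥-elim (<-irrefl refl (≤-<-trans l≤head (lastEdge<forced j⇒l (head∈ j) head∉l)))
    where
    tail∈l : tail j ∈ₑ u l
    tail∈l = [ id , ⊥-elim ∘ head∉l ]′ (Meets⇒tailOf⊎headOf (upward j) (u j) (u l) (Forces⇒Meets j⇒l))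
    l≤head : toℕ l ≤ lastTime (head j)
    l≤head = subst (_≤ lastTime (head j)) (cong toℕ (lastEdge-forced j⇒l (tail∈ j) tail∈l))
                   (lastTime-tail≤head j)

  head≡tail-forcee : ∀ {j l} → Forces j l → head j ≡ tail l
  head≡tail-forcee {l = l} j⇒l@(p , refl) =
    shared-vertex-unique (u-<-distinct (forcer< l p)) (head∈ _) (head∈forcee j⇒l) (tail∈forcer l p) (tail∈ l)

  lastEdge-at-tie : ∀ j → lastTime (tail j) ≡ lastTime (head j) →
                    lastEdge (tail j) ≡ j × lastEdge (head j) ≡ j
  lastEdge-at-tie j tie = tail-last , trans (sym same) tail-last
    where
    same : lastEdge (tail j) ≡ lastEdge (head j)
    same = toℕ-injective tie
    tail-last : lastEdge (tail j) ≡ j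
    tail-last = u-injective (edge-by-endpoints (tail≢head j) (lastEdge-∋ (tail j))
      (subst (λ i → head j ∈ₑ u i) (sym same) (lastEdge-∋ (head j))) (tail∈ j) (head∈ j))

  isHead : Fin n → ℕ
  isHead v = if does (head (lastEdge v) Fin.≟ v) then 1 else 0

  isHead≤1 : ∀ v → isHead v ≤ 1
  isHead≤1 v with does (head (lastEdge v) Fin.≟ v)
  ... | true  = ≤-refl
  ... | false = z≤n

  isHead-yes : ∀ {v} → head (lastEdge v) ≡ v → isHead v ≡ 1
  isHead-yes {v} h rewrite dec-true (head (lastEdge v) Fin.≟ v) h = refl

  isHead-no : ∀ {v} → head (lastEdge v) ≢ v → isHead v ≡ 0
  isHead-no {v} h rewrite dec-false (head (lastEdge v) Fin.≟ v) h = refl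

  rank : Fin n → ℕ
  rank v = isHead v + (lastTime v + lastTime v)

  rank-<-by-lastTime : ∀ {x y} → lastTime x < lastTime y → rank x < rank y
  rank-<-by-lastTime {x} {y} x<y = begin-strict
    rank x                         ≤⟨ +-monoˡ-≤ (lastTime x + lastTime x) (isHead≤1 x) ⟩
    suc (lastTime x + lastTime x)  <⟨ double-< x<y ⟩
    lastTime y + lastTime y        ≤⟨ m≤n+m _ (isHead y) ⟩
    rank y                         ∎
    where open ≤-Reasoning

  rank-increasing : ∀ j → rank (tail j) < rank (head j)
  rank-increasing j with m≤n⇒m<n∨m≡n (lastTime-tail≤head j)
  ... | inj₁ tail<head = rank-<-by-lastTime tail<head
  ... | inj₂ tie       = begin-strict
    rank (tail j)          ≡⟨ cong (_+ double (tail j)) tail-not-head ⟩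
    double (tail j)        <⟨ n<1+n _ ⟩
    suc (double (tail j))  ≡⟨ cong (λ t → suc (t + t)) tie ⟩
    suc (double (head j))  ≡⟨ cong (_+ double (head j)) (sym head-head) ⟩
    rank (head j)          ∎
    where
    open ≤-Reasoning
    double : Fin n → ℕ
    double v = lastTime v + lastTime v
    tail-not-head : isHead (tail j) ≡ 0
    tail-not-head = isHead-no (λ h → tail≢head j (trans (sym h) (cong head (proj₁ (lastEdge-at-tie j tie)))))
    head-head : isHead (head j) ≡ 1
    head-head = isHead-yes (cong head (proj₂ (lastEdge-at-tie j tie)))

  arc? : ∀ x y → Dec (∃ λ j → tail j ≡ x × head j ≡ y)
  arc? x y = any? (λ j → (tail j Fin.≟ x) ×-dec (head j Fin.≟ y))

  arcs : Fin n → Fin n → Bool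
  arcs x y = does (arc? x y)

  arcs-edge : ∀ j → arcs (tail j) (head j) ≡ true
  arcs-edge j = dec-true (arc? (tail j) (head j)) (j , refl , refl)

  arcs⇒edge : ∀ {x y} → arcs x y ≡ true → ∃ λ j → tail j ≡ x × head j ≡ y
  arcs⇒edge {x} {y} = does-true⇒ (arc? x y)

  arcs-increasing : ∀ {x y} → arcs x y ≡ true → rank x < rank y
  arcs-increasing xy with arcs⇒edge xy
  ... | j , refl , refl = rank-increasing j

  arcs-acyclic : Acyclic arcs
  arcs-acyclic = increasing⇒Acyclic rank arcs-increasing

  arcs-orientation : IsOrientation G arcs
  arcs-orientation = arcs⇒adj , adj⇒arcs , λ x y (xy , yx) → arcs-acyclic x (xy ◅ arc yx)
    where
    Arc : Fin n → Fin n → Set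
    Arc a b = arcs a b ≡ true
    arcs⇒adj : ∀ x y → arcs x y ≡ true → adj G x y ≡ true
    arcs⇒adj x y xy with arcs⇒edge xy
    ... | j , refl , refl = adj-tailOf-headOf (upward j) (u j)
    adj⇒arcs : ∀ x y → adj G x y ≡ true → arcs x y ≡ true ⊎ arcs y x ≡ true
    adj⇒arcs x y x~y with adj⇒edge x~y
    ... | e , x∈e , y∈e with u-surjective e
    ...   | j , refl with oriented-endpoints (upward j) (u j) (adj⇒≢ x~y) x∈e y∈e
    ...     | inj₁ (tail≡x , head≡y) = inj₁ (subst₂ Arc tail≡x head≡y (arcs-edge j))
    ...     | inj₂ (tail≡y , head≡x) = inj₂ (subst₂ Arc tail≡y head≡x (arcs-edge j))

  walk : ℕ → Fin m → List (Fin n)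
  walk zero    j = head j ∷ []
  walk (suc f) j = head j ∷ maybe (walk f) [] (forcee j)

  walk-first-arc : ∀ f j → Consec (tail j ∷ walk f j) (tail j) (head j)
  walk-first-arc zero    j = here
  walk-first-arc (suc f) j = here

  walk-arcs : ∀ f j {x y} → Consec (tail j ∷ walk f j) x y → arcs x y ≡ true
  walk-arcs zero    j here              = arcs-edge j
  walk-arcs zero    j (there (there ()))
  walk-arcs (suc f) j here              = arcs-edge j
  walk-arcs (suc f) j (there c) with forcee j in eq
  ... | nothing = ⊥-elim (Consec-singleton c)
    where
    Consec-singleton : ∀ {A : Set} {z a b : A} → ¬ Consec (z ∷ []) a b
    Consec-singleton (there ())
  ... | just l  =
    walk-arcs f l (subst (λ z → Consec (z ∷ walk f l) _ _) (head≡tail-forcee (forcee-sound eq)) c)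

  initial : Fin k → Fin m
  initial i = inject≤ i k≤m

  brush : Fin k → List (Fin n)
  brush i = tail (initial i) ∷ walk m (initial i)

  brush-path : ∀ i → IsDirPath arcs (brush i)
  brush-path i = increasing⇒Unique rank (brush i) (arcs-increasing ∘ walk-arcs m (initial i)) ,
                 λ _ _ → walk-arcs m (initial i)

  -- m ≤ j + f: the fuel left when the walk reaches e_j is at least the number of edges from e_j on.
  edge-on-brush : ∀ bound j → toℕ j < bound →
                  ∃ λ i → ∃ λ f → m ≤ toℕ j + f × Suffix _≡_ (tail j ∷ walk f j) (brush i)
  edge-on-brush (suc bound) j j<bound with k ≤? toℕ j
  ... | no k≰j = i , m , m≤n+m m (toℕ j) ,
    subst (λ a → Suffix _≡_ (tail a ∷ walk m a) (brush i)) initial-i≡j (here (≡⇒Pointwise-≡ refl))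
    where
    i : Fin k
    i = fromℕ< (≰⇒> k≰j)
    initial-i≡j : initial i ≡ j
    initial-i≡j = toℕ-injective (trans (toℕ-inject≤ i k≤m) (toℕ-fromℕ< (≰⇒> k≰j)))
  ... | yes p with edge-on-brush bound (forcer j p) (≤-trans (forcer< j p) (≤-pred j<bound))
  ...   | i , zero , m≤a+0 , _ =
    ⊥-elim (<-irrefl refl (<-≤-trans (toℕ<n (forcer j p)) (subst (m ≤_) (+-identityʳ _) m≤a+0)))
  ...   | i , suc f , m≤a+1+f , a∷walk≤brush = i , f , m≤j+f ,
    subst₂ (λ v w → Suffix _≡_ (v ∷ maybe (walk f) [] w) (brush i))
           (head≡tail-forcee (p , refl)) (forcee-complete (p , refl)) (Suffix.tail a∷walk≤brush)
    where
    m≤j+f : m ≤ toℕ j + f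
    m≤j+f = ≤-trans m≤a+1+f (≤-trans (≤-reflexive (+-suc _ f)) (+-monoˡ-≤ f (forcer< j p)))

  brush-covers : ∀ x y → arcs x y ≡ true → ∃ λ i → Consec (brush i) x y
  brush-covers x y xy with arcs⇒edge xy
  ... | j , refl , refl with edge-on-brush (suc (toℕ j)) j ≤-refl
  ...   | i , f , _ , walk≤brush = i , Consec-suffix walk≤brush (walk-first-arc f j)

  brushable : Brushable G k
  brushable = arcs , arcs-orientation , arcs-acyclic , brush , brush-path , brush-covers

theorem1 : ∀ (n : ℕ) (G : SimpleGraph n) → 1 ≤ n → NoIsolatedVertices G →
    ∀ (k : ℕ) → 1 ≤ k → HasZeroForcing (LineAdj G) k →
    Σ ℕ (λ k' → 1 ≤ k' × k' ≤ k × Brushable G k')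
theorem1 n G _ noIso k 1≤k (m , u , (u-injective , u-surjective) , k≤m , forcing) =
  k , 1≤k , ≤-refl ,
  FromZeroForcing.brushable G noIso u u-injective (λ e → map₂ (λ f → f refl) (u-surjective e)) k≤m forcing
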